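{- Fix an integer $r\ge3$. For $r-2\le d\le n/2$, any $K_{1,1,r-2}$-free graph on $n$ vertices with minimum degree at least $d$ has fractional chromatic number at most $\binom{n}{r-2}/\binom{d}{r-2}$, and thus contains a bipartite induced subgraph of minimum degree at least $\frac{d}{2}\binom{d}{r-2}/\binom{n}{r-2}$.
   Context: $K_{1,1,r-2}$ is the complete tripartite graph with parts of sizes $1,1,r-2$; a graph is $K_{1,1,r-2}$-free if it contains no subgraph isomorphic to $K_{1,1,r-2}$. A bipartite induced subgraph is a subgraph induced by a nonempty vertex set which is bipartite. -}

module Defs where

open import Data.Bool using (Bool; true; false; T; _∧_; not)
open import Data.Nat using (ℕ; zero; suc; _+_; _*_; _∸_; _≤_)
open import Data.Nat.Combinatorics using (_C_)
open import Data.Fin using (Fin; splitAt)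
open import Data.Fin.Properties using (_≟_)
open import Data.Fin.Subset using (Subset; _∈_; Nonempty)
open import Data.Sum using (_⊎_; inj₁; inj₂)
open import Data.List using (List; []; _∷_; length; filterᵇ; map; foldr)
open import Data.List.Relation.Unary.All using (All)
open import Data.Product using (Σ; ∃; _×_; _,_; proj₁; proj₂)
open import Data.Integer using (+_)
open import Data.Rational using (ℚ; _/_; 0ℚ; 1ℚ) renaming (_+_ to _+ℚ_; _*_ to _*ℚ_; _≤_ to _≤ℚ_)
open import Function.Definitions using (Injective)
open import Relation.Binary.PropositionalEquality using (_≡_; _≢_)
open import Relation.Nullary using (¬_; does)
import Data.Fin as Fin
import Data.List as L

record Graph (n : ℕ) : Set where
  field
    adj    : Fin n → Fin n → Bool
    sym    : ∀ x y → adj x y ≡ adj y x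
    irrefl : ∀ x → adj x x ≡ false
open Graph public

Adj : ∀ {n} → Graph n → Fin n → Fin n → Set
Adj G x y = T (adj G x y)

vertices : ∀ n → List (Fin n)
vertices n = L.allFin n

degree : ∀ {n} → Graph n → Fin n → ℕ
degree {n} G v = length (filterᵇ (adj G v) (vertices n))

MinDegreeAtLeast : ∀ {n} → Graph n → ℕ → Set
MinDegreeAtLeast G d = ∀ v → d ≤ degree G v

_⊆ᴳ_ : ∀ {m n} → Graph m → Graph n → Set
_⊆ᴳ_ {m} {n} H G = Σ (Fin m → Fin n) λ f →
  Injective _≡_ _≡_ f × (∀ x y → Adj H x y → Adj G (f x) (f y))

tripartPart : ∀ a b c → Fin (a + b + c) → Fin 3
tripartPart a b c i with splitAt (a + b) i
... | inj₂ _ = Fin.suc (Fin.suc Fin.zero)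
... | inj₁ j with splitAt a j
...   | inj₁ _ = Fin.zero
...   | inj₂ _ = Fin.suc Fin.zero

completeTripartite : ∀ a b c → Graph (a + b + c)
completeTripartite a b c = record
  { adj    = λ x y → not (does (tripartPart a b c x ≟ tripartPart a b c y))
  ; sym    = λ x y → symLemma x y
  ; irrefl = λ x → irr x
  }
  where
  open import Relation.Binary.PropositionalEquality using (refl) renaming (sym to ≡sym)
  open import Relation.Nullary using (yes; no)
  symLemma : ∀ x y → not (does (tripartPart a b c x ≟ tripartPart a b c y))
                   ≡ not (does (tripartPart a b c y ≟ tripartPart a b c x))
  symLemma x y with tripartPart a b c x ≟ tripartPart a b c y | tripartPart a b c y ≟ tripartPart a b c x
  ... | yes _ | yes _ = refl
  ... | no _  | no _  = refl
  ... | yes p | no q  = Data.Empty.⊥-elim (q (≡sym p))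
    where import Data.Empty
  ... | no p  | yes q = Data.Empty.⊥-elim (p (≡sym q))
    where import Data.Empty
  irr : ∀ x → not (does (tripartPart a b c x ≟ tripartPart a b c x)) ≡ false
  irr x with tripartPart a b c x ≟ tripartPart a b c x
  ... | yes _ = refl
  ... | no p  = Data.Empty.⊥-elim (p refl)
    where import Data.Empty

TripartiteFree : ∀ {n} → ℕ → ℕ → ℕ → Graph n → Set
TripartiteFree a b c G = ¬ (completeTripartite a b c ⊆ᴳ G)

Independent : ∀ {n} → Graph n → Subset n → Set
Independent G S = ∀ x y → x ∈ S → y ∈ S → ¬ Adj G x y

ℕtoℚ : ℕ → ℚ
ℕtoℚ k = + k / 1

sumℚ : List ℚ → ℚ
sumℚ = foldr _+ℚ_ 0ℚ

memberᵇ : ∀ {n} → Fin n → Subset n → Bool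
memberᵇ x S = Data.Vec.lookup S x
  where import Data.Vec

record FractionalColouring {n} (G : Graph n) : Set where
  field
    family      : List (Subset n × ℚ)
    independent : All (λ p → Independent G (proj₁ p)) family
    nonneg      : All (λ p → 0ℚ ≤ℚ proj₂ p) family
    covers      : ∀ v → 1ℚ ≤ℚ sumℚ (map proj₂ (filterᵇ (λ p → memberᵇ v (proj₁ p)) family))
open FractionalColouring public

totalWeight : ∀ {n} {G : Graph n} → FractionalColouring G → ℚ
totalWeight χ = sumℚ (map proj₂ (family χ))

-- χ_f(G) ≤ q  (the fractional chromatic number is a minimum of a rational LP,
-- attained by some fractional colouring, so this is the standard meaning)
FracChromaticAtMost : ∀ {n} → Graph n → ℚ → Set
FracChromaticAtMost G q = Σ (FractionalColouring G) λ χ → totalWeight χ ≤ℚ q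

BipartiteInduced : ∀ {n} → Graph n → Subset n → Set
BipartiteInduced {n} G S = Nonempty S × Σ (Fin n → Bool) λ col →
  ∀ x y → x ∈ S → y ∈ S → Adj G x y → col x ≢ col y

inducedDegree : ∀ {n} → Graph n → Subset n → Fin n → ℕ
inducedDegree {n} G S v = length (filterᵇ (λ u → adj G v u ∧ memberᵇ u S) (vertices n))

-- a / b as a rational number (convention: value 0 when b = 0; only used
-- below with b ≠ 0)
_÷ℕ_ : ℕ → ℕ → ℚ
a ÷ℕ zero    = 0ℚ
a ÷ℕ (suc k) = + a / suc k

-- Write k = r - 2. For a k-set X of vertices let I_X be its common neighbourhood. If two adjacent
-- vertices lay in I_X, together with X they would span a K_{1,1,k}; so every I_X is independent.
-- A vertex x lies in I_X for exactly C(deg x, k) ≥ C(d, k) of the C(n, k) sets X, so the weight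
-- 1 / C(d, k) on each I_X is a fractional colouring of total weight C(n, k) / C(d, k).
-- For the bipartite subgraph, double count over ordered pairs (X, Y) of k-sets, with S = I_X ∪ I_Y
-- and m(x) the number of X with x ∈ I_X:
--   Σ |S| ≤ 2 C(n,k) Σ_x m(x),    Σ 2e(G[S]) ≥ 2 Σ_{x ~ u} m(x) m(u) ≥ 2 d C(d,k) Σ_x m(x),
-- where the first inequality of the second chain holds because no edge lies inside I_X. Hence some
-- pair has 2e(G[S]) / |S| ≥ d C(d,k) / C(n,k). Deleting a vertex of degree below half that ratio
-- keeps the ratio, so repeated deletion stops at a nonempty induced subgraph of G[S] of minimum
-- degree at least d C(d,k) / (2 C(n,k)); it is bipartite because it is covered by I_X and I_Y.
module Submission where

open import Defs hiding (sym)
open import Data.Nat using (ℕ; _≤_; _*_; _∸_)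
open import Data.Nat.Combinatorics using (_C_)
open import Data.Fin.Subset using (Subset; _∈_)
open import Data.Product using (Σ; _×_)
open import Data.Rational using () renaming (_≤_ to _≤ℚ_)

open import Data.Bool using (Bool; true; false; T; _∧_; _∨_; if_then_else_)
import Data.Bool.Properties as Bool
open import Data.Nat using (zero; suc; _+_; _<_; z≤n; s≤s; _<?_; >-nonZero; >-nonZero⁻¹)
import Data.Nat as ℕ
open import Data.Nat.Properties hiding (_≟_)
open import Data.Nat.Combinatorics using (nCk+nC[k+1]≡[n+1]C[k+1])
open import Data.Nat.Tactic.RingSolver using (solve-∀)
open import Algebra.Properties.CommutativeSemigroup +-commutativeSemigroup using (interchange)
open import Data.Fin using (Fin; zero; suc)
open import Data.Fin.Properties using (_≟_; any?)
open import Data.Fin.Subset using (Nonempty)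
open import Data.Integer using (ℤ; +≤+)
import Data.Integer as ℤ
open import Data.Integer.Properties using (pos-*)
import Data.Integer.Tactic.RingSolver as ℤ-Solver
open import Data.Rational using (ℚ; _/_; 1ℚ; toℚᵘ) renaming (_+_ to _+ℚ_)
import Data.Rational.Properties as ℚ
open import Data.Rational.Unnormalised using (mkℚᵘ; *≡*; *≤*) renaming (_+_ to _+ᵘ_; _≃_ to _≃ᵘ_)
import Data.Rational.Unnormalised.Properties as ℚᵘ
open import Data.List using (List; []; _∷_; [_]; length; map; filterᵇ; _++_; allFin; cartesianProduct)
open import Data.List.Properties using (length-++; length-map; length-tabulate; map-tabulate)
open import Data.List.Membership.Propositional using () renaming (_∈_ to _∈ₗ_)
open import Data.List.Membership.Propositional.Properties using (∈-++⁻; ∈-map⁻; ∈-cartesianProduct⁻)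
open import Data.List.Relation.Unary.Any using (here; there)
open import Data.List.Relation.Unary.All as ListAll using ([]; _∷_; universal)
open import Data.List.Relation.Unary.All.Properties using (map⁺; filter⁺)
import Data.List.Relation.Unary.Unique.Propositional as List
open import Data.List.Relation.Unary.AllPairs using (_∷_)
open import Data.List.Relation.Unary.Unique.Propositional.Properties using (allFin⁺)
open import Data.Vec using (Vec; []; _∷_; lookup; tabulate)
import Data.Vec as Vec
open import Data.Vec.Properties using (lookup∘tabulate; []=⇒lookup; lookup⇒[]=)
open import Data.Vec.Relation.Unary.All using (All; []; _∷_)
import Data.Vec.Relation.Unary.All as All
open import Data.Vec.Relation.Unary.Unique.Propositional using (Unique; []; _∷_)
open import Data.Vec.Relation.Unary.Unique.Propositional.Properties using (lookup-injective)
open import Data.Vec.Membership.Propositional.Properties using (∈-lookup)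
open import Data.Product using (∃-syntax; _,_; proj₁; proj₂; uncurry; map₁; map₂)
open import Data.Sum using (inj₁; inj₂)
open import Function using (_∘_; id)
open import Function.Bundles using (Equivalence)
open import Relation.Binary.PropositionalEquality hiding ([_])
open import Relation.Nullary using (¬_; yes; no; does; contradiction; T?)
open import Relation.Nullary.Decidable using (_×-dec_)

private variable
  A B : Set
  k : ℕ

𝟙 : Bool → ℕ
𝟙 true  = 1
𝟙 false = 0

𝟙-∧ : ∀ a b → 𝟙 (a ∧ b) ≡ 𝟙 a * 𝟙 b
𝟙-∧ true  true  = refl
𝟙-∧ true  false = refl
𝟙-∧ false _     = refl

𝟙*-pos : ∀ b m → 0 < 𝟙 b * m → b ≡ true
𝟙*-pos true _ _ = refl

𝟙-∨-≤ : ∀ p q → 𝟙 (p ∨ q) ≤ 𝟙 p + 𝟙 q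
𝟙-∨-≤ true  q = s≤s z≤n
𝟙-∨-≤ false q = ≤-refl

𝟙-≤-∨ : ∀ p q → 𝟙 p ≤ 𝟙 (p ∨ q)
𝟙-≤-∨ true  q = ≤-refl
𝟙-≤-∨ false q = z≤n

𝟙-cross-≤ : ∀ p q r s → p ∧ r ≡ false → 𝟙 p * 𝟙 s + 𝟙 q * 𝟙 r ≤ 𝟙 (p ∨ q) * 𝟙 (r ∨ s)
𝟙-cross-≤ false q r     s _ = *-monoʳ-≤ (𝟙 q) (𝟙-≤-∨ r s)
𝟙-cross-≤ true  q false s _ = ≤-reflexive (trans (cong (1 * 𝟙 s +_) (*-zeroʳ (𝟙 q))) (+-identityʳ _))

∑ : List A → (A → ℕ) → ℕ
∑ []       f = 0
∑ (x ∷ xs) f = f x + ∑ xs f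

infix 5 ∑
syntax ∑ xs (λ x → e) = ∑[ x ∈ xs ] e

∑-cong : ∀ (xs : List A) {f g : A → ℕ} → (∀ a → f a ≡ g a) → ∑ xs f ≡ ∑ xs g
∑-cong []       f≗g = refl
∑-cong (x ∷ xs) f≗g = cong₂ _+_ (f≗g x) (∑-cong xs f≗g)

∑-mono-≤-∈ : ∀ (xs : List A) {f g : A → ℕ} → (∀ {a} → a ∈ₗ xs → f a ≤ g a) → ∑ xs f ≤ ∑ xs g
∑-mono-≤-∈ []       f≤g = z≤n
∑-mono-≤-∈ (x ∷ xs) f≤g = +-mono-≤ (f≤g (here refl)) (∑-mono-≤-∈ xs (f≤g ∘ there))

∑-mono-≤ : ∀ (xs : List A) {f g : A → ℕ} → (∀ a → f a ≤ g a) → ∑ xs f ≤ ∑ xs g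
∑-mono-≤ xs f≤g = ∑-mono-≤-∈ xs (λ {a} _ → f≤g a)

∑-distrib-+ : ∀ (xs : List A) (f g : A → ℕ) → ∑[ a ∈ xs ] (f a + g a) ≡ ∑ xs f + ∑ xs g
∑-distrib-+ []       f g = refl
∑-distrib-+ (x ∷ xs) f g =
  trans (cong (f x + g x +_) (∑-distrib-+ xs f g)) (interchange (f x) (g x) (∑ xs f) (∑ xs g))

∑-*ˡ : ∀ (xs : List A) c (f : A → ℕ) → ∑[ a ∈ xs ] (c * f a) ≡ c * ∑ xs f
∑-*ˡ []       c f = sym (*-zeroʳ c)
∑-*ˡ (x ∷ xs) c f = trans (cong (c * f x +_) (∑-*ˡ xs c f)) (sym (*-distribˡ-+ c (f x) _))

∑-*ʳ : ∀ (xs : List A) c (f : A → ℕ) → ∑[ a ∈ xs ] (f a * c) ≡ ∑ xs f * c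
∑-*ʳ xs c f = trans (∑-cong xs (λ a → *-comm (f a) c)) (trans (∑-*ˡ xs c f) (*-comm c _))

∑-const : ∀ (xs : List A) c → ∑[ _ ∈ xs ] c ≡ length xs * c
∑-const []       c = refl
∑-const (x ∷ xs) c = cong (c +_) (∑-const xs c)

∑-comm : ∀ (xs : List A) (ys : List B) (f : A → B → ℕ) →
         ∑[ a ∈ xs ] ∑[ b ∈ ys ] f a b ≡ ∑[ b ∈ ys ] ∑[ a ∈ xs ] f a b
∑-comm []       ys f = sym (trans (∑-const ys 0) (*-zeroʳ (length ys)))
∑-comm (x ∷ xs) ys f = trans (cong (∑ ys (f x) +_) (∑-comm xs ys f)) (sym (∑-distrib-+ ys (f x) _))

∑-++ : ∀ (xs ys : List A) (f : A → ℕ) → ∑ (xs ++ ys) f ≡ ∑ xs f + ∑ ys f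
∑-++ []       ys f = refl
∑-++ (x ∷ xs) ys f = trans (cong (f x +_) (∑-++ xs ys f)) (sym (+-assoc (f x) _ _))

∑-map : ∀ (g : A → B) (xs : List A) (f : B → ℕ) → ∑ (map g xs) f ≡ ∑[ a ∈ xs ] f (g a)
∑-map g []       f = refl
∑-map g (x ∷ xs) f = cong (f (g x) +_) (∑-map g xs f)

∑-cartesianProduct : ∀ (xs : List A) (ys : List B) (f : A → B → ℕ) →
                     ∑ (cartesianProduct xs ys) (uncurry f) ≡ ∑[ a ∈ xs ] ∑[ b ∈ ys ] f a b
∑-cartesianProduct []       ys f = refl
∑-cartesianProduct (x ∷ xs) ys f = begin
  ∑ (map (x ,_) ys ++ cartesianProduct xs ys) (uncurry f)
    ≡⟨ ∑-++ (map (x ,_) ys) _ (uncurry f) ⟩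
  ∑ (map (x ,_) ys) (uncurry f) + ∑ (cartesianProduct xs ys) (uncurry f)
    ≡⟨ cong₂ _+_ (∑-map (x ,_) ys (uncurry f)) (∑-cartesianProduct xs ys f) ⟩
  ∑ ys (f x) + (∑[ a ∈ xs ] ∑[ b ∈ ys ] f a b) ∎
  where open ≡-Reasoning

length-filterᵇ : ∀ (p : A → Bool) xs → length (filterᵇ p xs) ≡ ∑[ a ∈ xs ] 𝟙 (p a)
length-filterᵇ p []       = refl
length-filterᵇ p (x ∷ xs) with p x
... | true  = cong suc (length-filterᵇ p xs)
... | false = length-filterᵇ p xs

∑-pos : ∀ (xs : List A) {f : A → ℕ} → 0 < ∑ xs f → ∃[ a ] a ∈ₗ xs × 0 < f a
∑-pos (x ∷ xs) {f} 0<∑ with f x ℕ.≟ 0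
... | no  fx≢0 = x , here refl , n≢0⇒n>0 fx≢0
... | yes fx≡0 with a , a∈xs , 0<fa ← ∑-pos xs (subst (λ y → 0 < y + ∑ xs f) fx≡0 0<∑) =
  a , there a∈xs , 0<fa

∑-zero : ∀ (xs : List A) {f g : A → ℕ} → (∀ a → f a ≡ 0 → g a ≡ 0) → ∑ xs f ≡ 0 → ∑ xs g ≡ 0
∑-zero []       f0⇒g0 _    = refl
∑-zero (x ∷ xs) {f} f0⇒g0 ∑≡0 =
  cong₂ _+_ (f0⇒g0 x (m+n≡0⇒m≡0 (f x) ∑≡0)) (∑-zero xs f0⇒g0 (m+n≡0⇒n≡0 (f x) ∑≡0))

∑-averaging : ∀ (xs : List A) {f g : A → ℕ} → (∀ a → f a ≡ 0 → g a ≡ 0) →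
              ∑ xs f ≤ ∑ xs g → 0 < ∑ xs f → ∃[ a ] a ∈ₗ xs × 0 < f a × f a ≤ g a
∑-averaging (x ∷ xs) {f} {g} f0⇒g0 ∑f≤∑g 0<∑f with 0 <? f x ×-dec f x ≤? g x
... | yes (0<fx , fx≤gx) = x , here refl , 0<fx , fx≤gx
... | no ¬found = map₂ (map₁ there) (∑-averaging xs f0⇒g0 ∑f≤∑g′ 0<∑f′)
  where
  gx≤fx : g x ≤ f x
  gx≤fx with f x ℕ.≟ 0
  ... | yes fx≡0 = ≤-reflexive (trans (f0⇒g0 x fx≡0) (sym fx≡0))
  ... | no fx≢0  = <⇒≤ (≰⇒> (λ fx≤gx → ¬found (n≢0⇒n>0 fx≢0 , fx≤gx)))
  ∑f≤∑g′ : ∑ xs f ≤ ∑ xs g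
  ∑f≤∑g′ = +-cancelˡ-≤ (f x) _ _ (≤-trans ∑f≤∑g (+-monoˡ-≤ (∑ xs g) gx≤fx))
  0<∑f′ : 0 < ∑ xs f
  0<∑f′ with ∑ xs f ℕ.≟ 0
  ... | no ∑f≢0 = n≢0⇒n>0 ∑f≢0
  ... | yes ∑f≡0 = contradiction (0<fx , fx≤gx) ¬found
    where
    ∑g≡0 = ∑-zero xs f0⇒g0 ∑f≡0
    0<fx : 0 < f x
    0<fx = subst (0 <_) (trans (cong (f x +_) ∑f≡0) (+-identityʳ (f x))) 0<∑f
    fx≤gx : f x ≤ g x
    fx≤gx = subst₂ _≤_ (trans (cong (f x +_) ∑f≡0) (+-identityʳ (f x)))
                       (trans (cong (g x +_) ∑g≡0) (+-identityʳ (g x))) ∑f≤∑g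

*-pos⇒posʳ : ∀ m {n} → 0 < m * n → 0 < n
*-pos⇒posʳ m 0<mn = >-nonZero⁻¹ _ {{m*n≢0⇒n≢0 m {{>-nonZero 0<mn}}}}

∑-allFin-suc : ∀ m (f : Fin (suc m) → ℕ) → ∑ (allFin (suc m)) f ≡ f zero + (∑[ y ∈ allFin m ] f (suc y))
∑-allFin-suc m f =
  cong (f zero +_) (trans (cong (λ ys → ∑ ys f) (sym (map-tabulate id suc))) (∑-map suc (allFin m) f))

∑-allFin-indicator : ∀ {m} (x : Fin m) (g : Fin m → ℕ) → ∑[ y ∈ allFin m ] 𝟙 (does (y ≟ x)) * g y ≡ g x
∑-allFin-indicator {suc m} zero g = begin
  ∑[ y ∈ allFin (suc m) ] 𝟙 (does (y ≟ zero)) * g y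
    ≡⟨ ∑-allFin-suc m (λ y → 𝟙 (does (y ≟ zero)) * g y) ⟩
  g zero + 0 + (∑[ y ∈ allFin m ] 0)
    ≡⟨ cong₂ _+_ (+-identityʳ (g zero)) (trans (∑-const (allFin m) 0) (*-zeroʳ (length (allFin m)))) ⟩
  g zero + 0
    ≡⟨ +-identityʳ (g zero) ⟩
  g zero ∎
  where open ≡-Reasoning
∑-allFin-indicator {suc m} (suc x) g =
  trans (∑-allFin-suc m (λ y → 𝟙 (does (y ≟ suc x)) * g y)) (∑-allFin-indicator x (g ∘ suc))

nCk≤[n+1]Ck : ∀ n k → n C k ≤ suc n C k
nCk≤[n+1]Ck n zero    = ≤-refl
nCk≤[n+1]Ck n (suc k) = subst (n C suc k ≤_) (nCk+nC[k+1]≡[n+1]C[k+1] n k) (m≤n+m _ _)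

C-monoˡ-≤ : ∀ k {m n} → m ≤ n → m C k ≤ n C k
C-monoˡ-≤ k {m} {n} m≤n with m≤n⇒m<n∨m≡n m≤n
... | inj₂ refl = ≤-refl
C-monoˡ-≤ k {m} {suc n} _ | inj₁ (s≤s m≤n) = ≤-trans (C-monoˡ-≤ k m≤n) (nCk≤[n+1]Ck n k)

k≤n⇒0<nCk : ∀ {n} k → k ≤ n → 0 < n C k
k≤n⇒0<nCk             zero    _         = s≤s z≤n
k≤n⇒0<nCk {n = suc n} (suc k) (s≤s k≤n) =
  subst (0 <_) (nCk+nC[k+1]≡[n+1]C[k+1] n k) (≤-trans (k≤n⇒0<nCk k k≤n) (m≤m+n _ _))

combinations : ∀ k → List A → List (Vec A k)
combinations zero    xs       = [ [] ]
combinations (suc k) []       = []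
combinations (suc k) (x ∷ xs) = map (x ∷_) (combinations k xs) ++ combinations (suc k) xs

length-combinations : ∀ k (xs : List A) → length (combinations k xs) ≡ length xs C k
length-combinations zero    xs       = refl
length-combinations (suc k) []       = refl
length-combinations (suc k) (x ∷ xs) = begin
  length (map (x Vec.∷_) (combinations k xs) ++ combinations (suc k) xs)
    ≡⟨ length-++ (map (x Vec.∷_) (combinations k xs)) ⟩
  length (map (x Vec.∷_) (combinations k xs)) + length (combinations (suc k) xs)
    ≡⟨ cong₂ _+_ (trans (length-map (x Vec.∷_) (combinations k xs)) (length-combinations k xs))
                 (length-combinations (suc k) xs) ⟩
  length xs C k + length xs C suc k
    ≡⟨ nCk+nC[k+1]≡[n+1]C[k+1] (length xs) k ⟩
  suc (length xs) C suc k ∎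
  where open ≡-Reasoning

allᵇ : (A → Bool) → Vec A k → Bool
allᵇ p []       = true
allᵇ p (x ∷ xs) = p x ∧ allᵇ p xs

allᵇ⇒All : ∀ (p : A → Bool) (xs : Vec A k) → allᵇ p xs ≡ true → All (λ x → p x ≡ true) xs
allᵇ⇒All p []       _  = []
allᵇ⇒All p (x ∷ xs) eq with p x in px
... | true = px ∷ allᵇ⇒All p xs eq

∑-combinations-suc : ∀ k x (xs : List A) (f : Vec A (suc k) → ℕ) →
                     ∑ (combinations (suc k) (x ∷ xs)) f
                       ≡ (∑[ X ∈ combinations k xs ] f (x ∷ X)) + ∑ (combinations (suc k) xs) f
∑-combinations-suc k x xs f =
  trans (∑-++ (map (x Vec.∷_) (combinations k xs)) _ f) (cong (_+ _) (∑-map (x Vec.∷_) (combinations k xs) f))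

count-combinations : ∀ (p : A → Bool) k xs →
                     ∑[ X ∈ combinations k xs ] 𝟙 (allᵇ p X) ≡ length (filterᵇ p xs) C k
count-combinations p zero    xs       = refl
count-combinations p (suc k) []       = refl
count-combinations p (suc k) (x ∷ xs) with p x in px
... | true = begin
  ∑ (combinations (suc k) (x ∷ xs)) (𝟙 ∘ allᵇ p)
    ≡⟨ ∑-combinations-suc k x xs (𝟙 ∘ allᵇ p) ⟩
  (∑[ X ∈ combinations k xs ] 𝟙 (p x ∧ allᵇ p X)) + ∑ (combinations (suc k) xs) (𝟙 ∘ allᵇ p)
    ≡⟨ cong₂ _+_ (trans (∑-cong (combinations k xs) (λ X → cong (λ b → 𝟙 (b ∧ allᵇ p X)) px))
                        (count-combinations p k xs))
                 (count-combinations p (suc k) xs) ⟩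
  length (filterᵇ p xs) C k + length (filterᵇ p xs) C suc k
    ≡⟨ nCk+nC[k+1]≡[n+1]C[k+1] (length (filterᵇ p xs)) k ⟩
  suc (length (filterᵇ p xs)) C suc k ∎
  where open ≡-Reasoning
... | false = trans (∑-combinations-suc k x xs (𝟙 ∘ allᵇ p))
  (cong₂ _+_ (trans (∑-cong (combinations k xs) (λ X → cong (λ b → 𝟙 (b ∧ allᵇ p X)) px))
                    (trans (∑-const (combinations k xs) 0) (*-zeroʳ (length (combinations k xs)))))
             (count-combinations p (suc k) xs))

∈-combinations⇒⊆ : ∀ k (xs : List A) {X} → X ∈ₗ combinations k xs → All (_∈ₗ xs) X
∈-combinations⇒⊆ zero    xs       (here refl) = []
∈-combinations⇒⊆ (suc k) (x ∷ xs) X∈ with ∈-++⁻ (map (x Vec.∷_) (combinations k xs)) X∈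
... | inj₁ X∈map with X′ , X′∈ , refl ← ∈-map⁻ (x Vec.∷_) X∈map =
  here refl ∷ All.map there (∈-combinations⇒⊆ k xs X′∈)
... | inj₂ X∈rest = All.map there (∈-combinations⇒⊆ (suc k) xs X∈rest)

∈-combinations⇒Unique : ∀ k {xs : List A} → List.Unique xs → ∀ {X} → X ∈ₗ combinations k xs → Unique X
∈-combinations⇒Unique zero    _              (here refl) = []
∈-combinations⇒Unique (suc k) {x ∷ xs} (x∉xs ∷ uniq) X∈
  with ∈-++⁻ (map (x Vec.∷_) (combinations k xs)) X∈
... | inj₁ X∈map with X′ , X′∈ , refl ← ∈-map⁻ (x Vec.∷_) X∈map =
  All.map (ListAll.lookup x∉xs) (∈-combinations⇒⊆ k xs X′∈) ∷ ∈-combinations⇒Unique k uniq X′∈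
... | inj₂ X∈rest = ∈-combinations⇒Unique (suc k) uniq X∈rest

/-mono-≤ : ∀ a b c e → a * suc e ≤ c * suc b → (ℤ.+ a / suc b) ≤ℚ (ℤ.+ c / suc e)
/-mono-≤ a b c e ae≤cb = ℚ.toℚᵘ-cancel-≤
  (ℚᵘ.≤-respˡ-≃ (ℚᵘ.≃-sym (ℚ.toℚᵘ-fromℚᵘ (mkℚᵘ (ℤ.+ a) b)))
    (ℚᵘ.≤-respʳ-≃ (ℚᵘ.≃-sym (ℚ.toℚᵘ-fromℚᵘ (mkℚᵘ (ℤ.+ c) e)))
      (*≤* (subst₂ ℤ._≤_ (pos-* a (suc e)) (pos-* c (suc b)) (+≤+ ae≤cb)))))

-- The case b = 0 holds only because of the junk value a ÷ℕ 0 = 0.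
÷ℕ-≤ : ∀ a b c → a ≤ c * b → (a ÷ℕ b) ≤ℚ ℕtoℚ c
÷ℕ-≤ a zero    c _    = /-mono-≤ 0 0 c 0 z≤n
÷ℕ-≤ a (suc b) c a≤cb = /-mono-≤ a b c 0 (subst (_≤ c * suc b) (sym (*-identityʳ a)) a≤cb)

+-sameDenominator : ∀ a c b → (ℤ.+ a / suc b) +ℚ (ℤ.+ c / suc b) ≡ ℤ.+ (a + c) / suc b
+-sameDenominator a c b = ℚ.toℚᵘ-injective
  (ℚᵘ.≃-trans (ℚ.toℚᵘ-homo-+ (ℤ.+ a / suc b) (ℤ.+ c / suc b))
  (ℚᵘ.≃-trans (ℚᵘ.+-cong (ℚ.toℚᵘ-fromℚᵘ (mkℚᵘ (ℤ.+ a) b))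
                         (ℚ.toℚᵘ-fromℚᵘ (mkℚᵘ (ℤ.+ c) b)))
  (ℚᵘ.≃-trans sameDenominator (ℚᵘ.≃-sym (ℚ.toℚᵘ-fromℚᵘ (mkℚᵘ (ℤ.+ (a + c)) b))))))
  where
  identity : ∀ (x y s : ℤ) → (x ℤ.* s ℤ.+ y ℤ.* s) ℤ.* s ≡ (x ℤ.+ y) ℤ.* (s ℤ.* s)
  identity = ℤ-Solver.solve-∀
  sameDenominator : mkℚᵘ (ℤ.+ a) b +ᵘ mkℚᵘ (ℤ.+ c) b ≃ᵘ mkℚᵘ (ℤ.+ (a + c)) b
  sameDenominator = *≡* (trans (identity (ℤ.+ a) (ℤ.+ c) (ℤ.+ suc b))
                               (cong (ℤ.+ (a + c) ℤ.*_) (sym (pos-* (suc b) (suc b)))))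

sumℚ-constant : ∀ b (ps : List (A × ℚ)) → ListAll.All ((_≡ ℤ.+ 1 / suc b) ∘ proj₂) ps →
                sumℚ (map proj₂ ps) ≡ ℤ.+ length ps / suc b
sumℚ-constant b []       []           =
  ℚ.toℚᵘ-injective (ℚᵘ.≃-sym (ℚᵘ.≃-trans (ℚ.toℚᵘ-fromℚᵘ (mkℚᵘ (ℤ.+ 0) b)) (*≡* refl)))
sumℚ-constant b (p ∷ ps) (refl ∷ ps≡) =
  trans (cong ((ℤ.+ 1 / suc b) +ℚ_) (sumℚ-constant b ps ps≡)) (+-sameDenominator 1 (length ps) b)

deletion-preserves-ratio : ∀ A N s e g → A * suc s ≤ N * (e + 2 * g) → g * (2 * N) < A → A * s < N * e
deletion-preserves-ratio A N s e g ≤before low = +-cancelʳ-< A (A * s) (N * e) (begin-strict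
  A * s + A           ≡⟨ +-comm (A * s) A ⟩
  A + A * s           ≡⟨ *-suc A s ⟨
  A * suc s           ≤⟨ ≤before ⟩
  N * (e + 2 * g)     ≡⟨ rearrange N e g ⟩
  N * e + g * (2 * N) <⟨ +-monoʳ-< (N * e) low ⟩
  N * e + A           ∎)
  where
  open ≤-Reasoning
  rearrange : ∀ N e g → N * (e + 2 * g) ≡ N * e + g * (2 * N)
  rearrange = solve-∀

∈-tabulate⁻ : ∀ {n} {f : Fin n → Bool} {x} → x ∈ tabulate f → f x ≡ true
∈-tabulate⁻ {f = f} {x} x∈ = trans (sym (lookup∘tabulate f x)) ([]=⇒lookup x∈)

∈-tabulate⁺ : ∀ {n} {f : Fin n → Bool} {x} → f x ≡ true → x ∈ tabulate f
∈-tabulate⁺ {f = f} {x} fx = lookup⇒[]= x (tabulate f) (trans (lookup∘tabulate f x) fx)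

module InducedSubgraphs {n : ℕ} (G : Graph n) where

  V : List (Fin n)
  V = vertices n

  ≡true⇒Adj : ∀ {x y} → adj G x y ≡ true → Adj G x y
  ≡true⇒Adj = Equivalence.from Bool.T-≡

  Adj⇒≢ : ∀ {x y} → Adj G x y → x ≢ y
  Adj⇒≢ {x} x~y refl = subst T (irrefl G x) x~y

  IndependentSet : (Fin n → Bool) → Set
  IndependentSet A = ∀ {x y} → A x ≡ true → A y ≡ true → ¬ Adj G x y

  nbrWeight : (Fin n → ℕ) → Fin n → ℕ
  nbrWeight w x = ∑[ u ∈ V ] 𝟙 (adj G x u) * w u

  edgeWeight : (Fin n → ℕ) → (Fin n → ℕ) → ℕ
  edgeWeight w₁ w₂ = ∑[ x ∈ V ] w₁ x * nbrWeight w₂ x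

  size : (Fin n → Bool) → ℕ
  size S = ∑[ x ∈ V ] 𝟙 (S x)

  degIn : (Fin n → Bool) → Fin n → ℕ
  degIn S = nbrWeight (𝟙 ∘ S)

  degSum : (Fin n → Bool) → ℕ
  degSum S = edgeWeight (𝟙 ∘ S) (𝟙 ∘ S)

  size≡0⇒degSum≡0 : ∀ S → size S ≡ 0 → degSum S ≡ 0
  size≡0⇒degSum≡0 S = ∑-zero V (λ x 𝟙≡0 → cong (_* nbrWeight (𝟙 ∘ S) x) 𝟙≡0)

  inducedDegree-tabulate : ∀ S v → inducedDegree G (tabulate S) v ≡ degIn S v
  inducedDegree-tabulate S v = trans (length-filterᵇ _ V)
    (∑-cong V (λ u → trans (cong (λ b → 𝟙 (adj G v u ∧ b)) (lookup∘tabulate S u)) (𝟙-∧ (adj G v u) (S u))))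

  nbrWeight-const : ∀ c x → nbrWeight (λ _ → c) x ≡ degree G x * c
  nbrWeight-const c x = trans (∑-*ʳ V c (𝟙 ∘ adj G x)) (cong (_* c) (sym (length-filterᵇ (adj G x) V)))

  nbrWeight-mono-≤ : ∀ {w w′} → (∀ u → w u ≤ w′ u) → ∀ x → nbrWeight w x ≤ nbrWeight w′ x
  nbrWeight-mono-≤ w≤w′ x = ∑-mono-≤ V (λ u → *-monoʳ-≤ (𝟙 (adj G x u)) (w≤w′ u))

  ∑-nbrWeight : ∀ (ys : List B) (g : B → Fin n → ℕ) x →
                ∑[ b ∈ ys ] nbrWeight (g b) x ≡ nbrWeight (λ u → ∑[ b ∈ ys ] g b u) x
  ∑-nbrWeight ys g x = trans (∑-comm ys V _) (∑-cong V (λ u → ∑-*ˡ ys (𝟙 (adj G x u)) (λ b → g b u)))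

  edgeWeight-∑ˡ : ∀ (xs : List A) (f : A → Fin n → ℕ) w →
                  ∑[ a ∈ xs ] edgeWeight (f a) w ≡ edgeWeight (λ x → ∑[ a ∈ xs ] f a x) w
  edgeWeight-∑ˡ xs f w = trans (∑-comm xs V _) (∑-cong V (λ x → ∑-*ʳ xs (nbrWeight w x) (λ a → f a x)))

  edgeWeight-∑ʳ : ∀ (ys : List B) w (g : B → Fin n → ℕ) →
                  ∑[ b ∈ ys ] edgeWeight w (g b) ≡ edgeWeight w (λ u → ∑[ b ∈ ys ] g b u)
  edgeWeight-∑ʳ ys w g = trans (∑-comm ys V _)
    (∑-cong V (λ x → trans (∑-*ˡ ys (w x) (λ b → nbrWeight (g b) x)) (cong (w x *_) (∑-nbrWeight ys g x))))

  edgeWeight-bilinear : ∀ (xs : List A) (ys : List B) (f : A → Fin n → ℕ) (g : B → Fin n → ℕ) →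
                        ∑[ a ∈ xs ] ∑[ b ∈ ys ] edgeWeight (f a) (g b)
                          ≡ edgeWeight (λ x → ∑[ a ∈ xs ] f a x) (λ u → ∑[ b ∈ ys ] g b u)
  edgeWeight-bilinear xs ys f g = trans (∑-cong xs (λ a → edgeWeight-∑ʳ ys (f a) g)) (edgeWeight-∑ˡ xs f _)

  edgeWeight-≥ : ∀ {d D w} → MinDegreeAtLeast G d → (∀ x → D ≤ w x) →
                 (∑[ x ∈ V ] w x) * (D * d) ≤ edgeWeight w w
  edgeWeight-≥ {d} {D} {w} δ≥d D≤w = begin
    (∑[ x ∈ V ] w x) * (D * d) ≡⟨ ∑-*ʳ V (D * d) w ⟨
    ∑[ x ∈ V ] w x * (D * d)   ≤⟨ ∑-mono-≤ V (λ x → *-monoʳ-≤ (w x) (D*d≤ x)) ⟩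
    edgeWeight w w             ∎
    where
    open ≤-Reasoning
    D*d≤ : ∀ x → D * d ≤ nbrWeight w x
    D*d≤ x = begin
      D * d                 ≤⟨ *-monoʳ-≤ D (δ≥d x) ⟩
      D * degree G x        ≡⟨ trans (*-comm D _) (sym (nbrWeight-const D x)) ⟩
      nbrWeight (λ _ → D) x ≤⟨ nbrWeight-mono-≤ D≤w x ⟩
      nbrWeight w x         ∎

  _∖_ : (Fin n → Bool) → Fin n → Fin n → Bool
  (S ∖ x) y = if does (y ≟ x) then false else S y

  module Deletion (S : Fin n → Bool) (x : Fin n) (x∈S : S x ≡ true) where

    δ : Fin n → ℕ
    δ y = 𝟙 (does (y ≟ x))

    𝟙-split : ∀ y → 𝟙 (S y) ≡ 𝟙 ((S ∖ x) y) + δ y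
    𝟙-split y with y ≟ x
    ... | yes refl = cong 𝟙 x∈S
    ... | no  _    = sym (+-identityʳ _)

    ∖-⊆ : ∀ {y} → (S ∖ x) y ≡ true → S y ≡ true
    ∖-⊆ {y} with does (y ≟ x)
    ... | false = id

    size-∖ : size S ≡ suc (size (S ∖ x))
    size-∖ = begin
      size S
        ≡⟨ trans (∑-cong V 𝟙-split) (∑-distrib-+ V _ δ) ⟩
      size (S ∖ x) + (∑[ y ∈ V ] δ y)
        ≡⟨ cong (size (S ∖ x) +_) (trans (∑-cong V (λ y → sym (*-identityʳ (δ y)))) (∑-allFin-indicator x (λ _ → 1))) ⟩
      size (S ∖ x) + 1
        ≡⟨ +-comm _ 1 ⟩
      suc (size (S ∖ x)) ∎
      where open ≡-Reasoning

    degIn-∖ : ∀ y → degIn S y ≡ degIn (S ∖ x) y + 𝟙 (adj G y x)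
    degIn-∖ y = begin
      degIn S y
        ≡⟨ ∑-cong V (λ u → trans (cong (𝟙 (adj G y u) *_) (𝟙-split u)) (*-distribˡ-+ (𝟙 (adj G y u)) _ _)) ⟩
      ∑[ u ∈ V ] (𝟙 (adj G y u) * 𝟙 ((S ∖ x) u) + 𝟙 (adj G y u) * δ u)
        ≡⟨ ∑-distrib-+ V _ _ ⟩
      degIn (S ∖ x) y + (∑[ u ∈ V ] 𝟙 (adj G y u) * δ u)
        ≡⟨ cong (degIn (S ∖ x) y +_) (trans (∑-cong V (λ u → *-comm (𝟙 (adj G y u)) (δ u)))
                                            (∑-allFin-indicator x (𝟙 ∘ adj G y))) ⟩
      degIn (S ∖ x) y + 𝟙 (adj G y x) ∎
      where open ≡-Reasoning

    degIn-∖-self : degIn S x ≡ degIn (S ∖ x) x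
    degIn-∖-self = trans (degIn-∖ x) (trans (cong (λ b → degIn (S ∖ x) x + 𝟙 b) (irrefl G x)) (+-identityʳ _))

    degSum-∖ : degSum S ≡ degSum (S ∖ x) + 2 * degIn (S ∖ x) x
    degSum-∖ = begin
      degSum S
        ≡⟨ ∑-cong V (λ y → trans (cong₂ _*_ (𝟙-split y) (degIn-∖ y))
                                 (expand (𝟙 (S′ y)) (δ y) (degIn S′ y) (𝟙 (adj G y x)))) ⟩
      ∑[ y ∈ V ] (𝟙 (S′ y) * degIn S′ y
                   + (𝟙 (S′ y) * 𝟙 (adj G y x) + (δ y * degIn S′ y + δ y * 𝟙 (adj G y x))))
        ≡⟨ trans (∑-distrib-+ V _ _) (cong (degSum S′ +_) (trans (∑-distrib-+ V _ _)
             (cong ((∑[ y ∈ V ] 𝟙 (S′ y) * 𝟙 (adj G y x)) +_) (∑-distrib-+ V _ _)))) ⟩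
      degSum S′ + ((∑[ y ∈ V ] 𝟙 (S′ y) * 𝟙 (adj G y x))
                    + ((∑[ y ∈ V ] δ y * degIn S′ y) + (∑[ y ∈ V ] δ y * 𝟙 (adj G y x))))
        ≡⟨ cong (degSum S′ +_) (cong₂ _+_ inNbrs (cong₂ _+_ (∑-allFin-indicator x (degIn S′)) loop)) ⟩
      degSum S′ + 2 * degIn S′ x ∎
      where
      open ≡-Reasoning
      S′ = S ∖ x
      expand : ∀ a e D c → (a + e) * (D + c) ≡ a * D + (a * c + (e * D + e * c))
      expand = solve-∀
      inNbrs : ∑[ y ∈ V ] 𝟙 (S′ y) * 𝟙 (adj G y x) ≡ degIn S′ x
      inNbrs = ∑-cong V (λ y → trans (*-comm (𝟙 (S′ y)) _) (cong (λ b → 𝟙 b * 𝟙 (S′ y)) (Graph.sym G y x)))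
      loop : ∑[ y ∈ V ] δ y * 𝟙 (adj G y x) ≡ 0
      loop = trans (∑-allFin-indicator x (λ y → 𝟙 (adj G y x))) (cong 𝟙 (irrefl G x))

  record DenseCore (A N : ℕ) (S : Fin n → Bool) : Set where
    field
      core     : Fin n → Bool
      core⊆S   : ∀ {y} → core y ≡ true → S y ≡ true
      nonempty : ∃[ y ] core y ≡ true
      dense    : ∀ {y} → core y ≡ true → A ≤ degIn core y * (2 * N)

  denseCore : ∀ A N S → A * size S ≤ N * degSum S → 0 < degSum S → DenseCore A N S
  denseCore A N S = peel (size S) S refl
    where
    peel : ∀ s S → size S ≡ s → A * size S ≤ N * degSum S → 0 < degSum S → DenseCore A N S
    peel s S _ _ 0<degSum with any? (λ x → (S x Bool.≟ true) ×-dec (degIn S x * (2 * N) <? A))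
    ... | no noLowVertex = record
      { core     = S
      ; core⊆S   = id
      ; nonempty = let (y , _ , 0<) = ∑-pos V 0<degSum in y , 𝟙*-pos (S y) _ 0<
      ; dense    = λ {y} y∈S → ≮⇒≥ (λ low → noLowVertex (y , y∈S , low))
      }
    peel zero S size≡0 _ _ | yes (x , x∈S , _) = contradiction (trans (sym size-∖) size≡0) λ ()
      where open Deletion S x x∈S
    peel (suc s) S size≡1+s ≤ratio _ | yes (x , x∈S , low) =
      record { DenseCore smaller ; core⊆S = ∖-⊆ ∘ DenseCore.core⊆S smaller }
      where
      open Deletion S x x∈S
      <ratio : A * size (S ∖ x) < N * degSum (S ∖ x)
      <ratio = deletion-preserves-ratio A N _ _ (degIn (S ∖ x) x)
        (subst₂ (λ a b → A * a ≤ N * b) size-∖ degSum-∖ ≤ratio)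
        (subst (λ g → g * (2 * N) < A) degIn-∖-self low)
      smaller : DenseCore A N (S ∖ x)
      smaller = peel s (S ∖ x) (suc-injective (trans (sym size-∖) size≡1+s)) (<⇒≤ <ratio)
        (*-pos⇒posʳ N (≤-<-trans z≤n <ratio))

  _∪_ : (Fin n → Bool) → (Fin n → Bool) → Fin n → Bool
  (A ∪ B) x = A x ∨ B x

  size-∪-≤ : ∀ A B → size (A ∪ B) ≤ size A + size B
  size-∪-≤ A B =
    ≤-trans (∑-mono-≤ V (λ x → 𝟙-∨-≤ (A x) (B x))) (≤-reflexive (∑-distrib-+ V (𝟙 ∘ A) (𝟙 ∘ B)))

  size-≤-∪ : ∀ A B → size A ≤ size (A ∪ B)
  size-≤-∪ A B = ∑-mono-≤ V (λ x → 𝟙-≤-∨ (A x) (B x))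

  independent⇒∧≡false : ∀ {A} → IndependentSet A → ∀ {x u} → adj G x u ≡ true → A x ∧ A u ≡ false
  independent⇒∧≡false {A} indep {x} {u} x~u with A x in x∈A | A u in u∈A
  ... | true  | true  = contradiction (≡true⇒Adj x~u) (indep x∈A u∈A)
  ... | true  | false = refl
  ... | false | _     = refl

  -- Independence of A is what keeps an edge inside A from being counted twice on the left.
  cross-edgeWeight-≤-degSum : ∀ {A} B → IndependentSet A →
                              edgeWeight (𝟙 ∘ A) (𝟙 ∘ B) + edgeWeight (𝟙 ∘ B) (𝟙 ∘ A) ≤ degSum (A ∪ B)
  cross-edgeWeight-≤-degSum {A} B indep = begin
    edgeWeight (𝟙 ∘ A) (𝟙 ∘ B) + edgeWeight (𝟙 ∘ B) (𝟙 ∘ A)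
      ≡⟨ ∑-distrib-+ V _ _ ⟨
    ∑[ x ∈ V ] (𝟙 (A x) * nbrWeight (𝟙 ∘ B) x + 𝟙 (B x) * nbrWeight (𝟙 ∘ A) x)
      ≡⟨ ∑-cong V (λ x → trans (∑-distrib-+ V _ _) (cong₂ _+_ (∑-*ˡ V (𝟙 (A x)) _) (∑-*ˡ V (𝟙 (B x)) _))) ⟨
    ∑[ x ∈ V ] ∑[ u ∈ V ] (𝟙 (A x) * (𝟙 (adj G x u) * 𝟙 (B u)) + 𝟙 (B x) * (𝟙 (adj G x u) * 𝟙 (A u)))
      ≤⟨ ∑-mono-≤ V (λ x → ∑-mono-≤ V (λ u →
           pointwise (adj G x u) (A x) (B x) (A u) (B u) (independent⇒∧≡false indep))) ⟩
    ∑[ x ∈ V ] ∑[ u ∈ V ] 𝟙 ((A ∪ B) x) * (𝟙 (adj G x u) * 𝟙 ((A ∪ B) u))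
      ≡⟨ ∑-cong V (λ x → ∑-*ˡ V (𝟙 ((A ∪ B) x)) _) ⟩
    degSum (A ∪ B) ∎
    where
    open ≤-Reasoning
    factorˡ : ∀ p a s q r → p * (a * s) + q * (a * r) ≡ a * (p * s + q * r)
    factorˡ = solve-∀
    factorʳ : ∀ t a v → t * (a * v) ≡ a * (t * v)
    factorʳ = solve-∀
    pointwise : ∀ a p q r s → (a ≡ true → p ∧ r ≡ false) →
                𝟙 p * (𝟙 a * 𝟙 s) + 𝟙 q * (𝟙 a * 𝟙 r) ≤ 𝟙 (p ∨ q) * (𝟙 a * 𝟙 (r ∨ s))
    pointwise a p q r s edge⇒disjoint
      rewrite factorˡ (𝟙 p) (𝟙 a) (𝟙 s) (𝟙 q) (𝟙 r) | factorʳ (𝟙 (p ∨ q)) (𝟙 a) (𝟙 (r ∨ s)) with a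
    ... | false = z≤n
    ... | true  = *-monoʳ-≤ 1 (𝟙-cross-≤ p q r s (edge⇒disjoint refl))

  denseUnion⇒bipartite : ∀ {A B a N} → IndependentSet A → IndependentSet B →
                         0 < a * size (A ∪ B) → a * size (A ∪ B) ≤ N * degSum (A ∪ B) →
                         Σ (Subset n) λ S → BipartiteInduced G S
                           × (∀ v → v ∈ S → (a ÷ℕ (2 * N)) ≤ℚ ℕtoℚ (inducedDegree G S v))
  denseUnion⇒bipartite {A} {B} {a} {N} indA indB 0<a·size ratio =
    tabulate core , (nonempty′ , A , proper) , degreeBound
    where
    open DenseCore (denseCore a N (A ∪ B) ratio (*-pos⇒posʳ N (≤-trans 0<a·size ratio)))
    nonempty′ : Nonempty (tabulate core)
    nonempty′ = let (y , y∈core) = nonempty in y , ∈-tabulate⁺ y∈core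
    inB : ∀ {z} → z ∈ tabulate core → A z ≡ false → B z ≡ true
    inB {z} z∈ z∉A = subst (λ b → b ∨ B z ≡ true) z∉A (core⊆S (∈-tabulate⁻ z∈))
    proper : ∀ x y → x ∈ tabulate core → y ∈ tabulate core → Adj G x y → A x ≢ A y
    proper x y x∈ y∈ x~y with A x in x∈A | A y in y∈A
    ... | true  | true  = λ _ → indA x∈A y∈A x~y
    ... | true  | false = λ ()
    ... | false | true  = λ ()
    ... | false | false = λ _ → indB (inB x∈ x∈A) (inB y∈ y∈A) x~y
    degreeBound : ∀ v → v ∈ tabulate core → (a ÷ℕ (2 * N)) ≤ℚ ℕtoℚ (inducedDegree G (tabulate core) v)
    degreeBound v v∈ = ÷ℕ-≤ a (2 * N) (inducedDegree G (tabulate core) v)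
      (subst (λ m → a ≤ m * (2 * N)) (sym (inducedDegree-tabulate core v)) (dense (∈-tabulate⁻ v∈)))

module CommonNeighbourhoods {n : ℕ} (G : Graph n) (k : ℕ) where

  open InducedSubgraphs G

  commonNbhd : Vec (Fin n) k → Fin n → Bool
  commonNbhd X x = allᵇ (adj G x) X

  commonNbhd-independent : ∀ {X} → TripartiteFree 1 1 k G → Unique X → IndependentSet (commonNbhd X)
  commonNbhd-independent {X} free uniq {x} {y} x∈I y∈I x~y =
    free (lookup (x ∷ y ∷ X) , lookup-injective distinct _ _ , edges)
    where
    x~X : All (λ z → adj G x z ≡ true) X
    x~X = allᵇ⇒All (adj G x) X x∈I
    y~X : All (λ z → adj G y z ≡ true) X
    y~X = allᵇ⇒All (adj G y) X y∈I
    x~ : ∀ i → Adj G x (lookup X i)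
    x~ i = ≡true⇒Adj (All.lookup x~X (∈-lookup i X))
    y~ : ∀ i → Adj G y (lookup X i)
    y~ i = ≡true⇒Adj (All.lookup y~X (∈-lookup i X))
    flip : ∀ {u v} → Adj G u v → Adj G v u
    flip {u} {v} = subst T (Graph.sym G u v)
    distinct : Unique (x ∷ y ∷ X)
    distinct = (Adj⇒≢ x~y ∷ All.map (Adj⇒≢ ∘ ≡true⇒Adj) x~X) ∷ All.map (Adj⇒≢ ∘ ≡true⇒Adj) y~X ∷ uniq
    edges : ∀ i j → Adj (completeTripartite 1 1 k) i j → Adj G (lookup (x ∷ y ∷ X) i) (lookup (x ∷ y ∷ X) j)
    edges zero          zero          ()
    edges zero          (suc zero)    _ = x~y
    edges zero          (suc (suc j)) _ = x~ j
    edges (suc zero)    zero          _ = flip x~y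
    edges (suc zero)    (suc zero)    ()
    edges (suc zero)    (suc (suc j)) _ = y~ j
    edges (suc (suc i)) zero          _ = flip (x~ i)
    edges (suc (suc i)) (suc zero)    _ = flip (y~ i)
    edges (suc (suc i)) (suc (suc j)) ()

  kSets : List (Vec (Fin n) k)
  kSets = combinations k V

  length-kSets : length kSets ≡ n C k
  length-kSets = trans (length-combinations k V) (cong (_C k) (length-tabulate id))

  ∈kSets⇒independent : TripartiteFree 1 1 k G → ∀ {X} → X ∈ₗ kSets → IndependentSet (commonNbhd X)
  ∈kSets⇒independent free X∈ = commonNbhd-independent free (∈-combinations⇒Unique k (allFin⁺ n) X∈)

  coverCount : Fin n → ℕ
  coverCount x = ∑[ X ∈ kSets ] 𝟙 (commonNbhd X x)

  coverCount-≥ : ∀ {d} → MinDegreeAtLeast G d → ∀ x → d C k ≤ coverCount x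
  coverCount-≥ δ≥d x = subst (_ ≤_) (sym (count-combinations (adj G x) k V)) (C-monoˡ-≤ k (δ≥d x))

  commonNbhdColouring : TripartiteFree 1 1 k G → ∀ D → 0 < D → (∀ x → D ≤ coverCount x) →
                        FracChromaticAtMost G (length kSets ÷ℕ D)
  commonNbhdColouring free (suc D′) _ D≤cover = χ , ℚ.≤-reflexive total
    where
    w = ℤ.+ 1 / suc D′
    weighted = map (λ X → tabulate (commonNbhd X) , w) kSets
    weights : ListAll.All ((_≡ w) ∘ proj₂) weighted
    weights = map⁺ (universal (λ _ → refl) kSets)
    covering : Fin n → List (Subset n × ℚ)
    covering v = filterᵇ (λ p → memberᵇ v (proj₁ p)) weighted
    length-covering : ∀ v → length (covering v) ≡ coverCount v
    length-covering v = trans (length-filterᵇ _ weighted) (trans (∑-map _ kSets _)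
                          (∑-cong kSets (λ X → cong 𝟙 (lookup∘tabulate (commonNbhd X) v))))
    covered : ∀ v → 1ℚ ≤ℚ sumℚ (map proj₂ (covering v))
    covered v = subst (1ℚ ≤ℚ_) (sym (sumℚ-constant D′ (covering v) (filter⁺ (T? ∘ _) weights)))
      (/-mono-≤ 1 0 (length (covering v)) D′ (subst₂ _≤_ (sym (+-identityʳ (suc D′))) (sym (*-identityʳ _))
        (subst (suc D′ ≤_) (sym (length-covering v)) (D≤cover v))))
    χ : FractionalColouring G
    χ = record
      { family      = weighted
      ; independent = map⁺ (ListAll.tabulate λ X∈ x y x∈ y∈ →
                        ∈kSets⇒independent free X∈ (∈-tabulate⁻ x∈) (∈-tabulate⁻ y∈))
      ; nonneg      = map⁺ (universal (λ _ → /-mono-≤ 0 0 1 D′ z≤n) kSets)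
      ; covers      = covered
      }
    total : totalWeight χ ≡ ℤ.+ length kSets / suc D′
    total = trans (sumℚ-constant D′ weighted weights) (cong (λ m → ℤ.+ m / suc D′) (length-map _ kSets))

  fractionalChromatic-≤ : ∀ {d} → TripartiteFree 1 1 k G → MinDegreeAtLeast G d → k ≤ d →
                          FracChromaticAtMost G ((n C k) ÷ℕ (d C k))
  fractionalChromatic-≤ {d} free δ≥d k≤d =
    subst (λ N → FracChromaticAtMost G (N ÷ℕ (d C k))) length-kSets
          (commonNbhdColouring free (d C k) (k≤n⇒0<nCk k k≤d) (coverCount-≥ δ≥d))

  pairs : List (Vec (Fin n) k × Vec (Fin n) k)
  pairs = cartesianProduct kSets kSets

  pairUnion : Vec (Fin n) k × Vec (Fin n) k → Fin n → Bool
  pairUnion (X , Y) = commonNbhd X ∪ commonNbhd Y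

  totalCover : ℕ
  totalCover = ∑[ x ∈ V ] coverCount x

  ∑∑-size-commonNbhdˡ : ∑[ X ∈ kSets ] ∑[ Y ∈ kSets ] size (commonNbhd X) ≡ length kSets * totalCover
  ∑∑-size-commonNbhdˡ = trans (∑-cong kSets (λ X → ∑-const kSets _))
    (trans (∑-*ˡ kSets (length kSets) (size ∘ commonNbhd)) (cong (length kSets *_) (∑-comm kSets V _)))

  ∑∑-size-commonNbhdʳ : ∑[ X ∈ kSets ] ∑[ Y ∈ kSets ] size (commonNbhd Y) ≡ length kSets * totalCover
  ∑∑-size-commonNbhdʳ = trans (∑-const kSets _) (cong (length kSets *_) (∑-comm kSets V _))

  ∑-size-pairUnion-≤ : ∑[ P ∈ pairs ] size (pairUnion P) ≤ 2 * (length kSets * totalCover)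
  ∑-size-pairUnion-≤ = begin
    ∑[ P ∈ pairs ] size (pairUnion P)
      ≡⟨ ∑-cartesianProduct kSets kSets _ ⟩
    ∑[ X ∈ kSets ] ∑[ Y ∈ kSets ] size (pairUnion (X , Y))
      ≤⟨ ∑-mono-≤ kSets (λ X → ∑-mono-≤ kSets (λ Y → size-∪-≤ (commonNbhd X) (commonNbhd Y))) ⟩
    ∑[ X ∈ kSets ] ∑[ Y ∈ kSets ] (size (commonNbhd X) + size (commonNbhd Y))
      ≡⟨ trans (∑-cong kSets (λ X → ∑-distrib-+ kSets _ _)) (∑-distrib-+ kSets _ _) ⟩
    (∑[ X ∈ kSets ] ∑[ Y ∈ kSets ] size (commonNbhd X)) + (∑[ X ∈ kSets ] ∑[ Y ∈ kSets ] size (commonNbhd Y))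
      ≡⟨ cong₂ _+_ ∑∑-size-commonNbhdˡ (trans ∑∑-size-commonNbhdʳ (sym (+-identityʳ _))) ⟩
    2 * (length kSets * totalCover) ∎
    where open ≤-Reasoning

  ∑-size-pairUnion-≥ : length kSets * totalCover ≤ ∑[ P ∈ pairs ] size (pairUnion P)
  ∑-size-pairUnion-≥ = begin
    length kSets * totalCover
      ≡⟨ ∑∑-size-commonNbhdˡ ⟨
    ∑[ X ∈ kSets ] ∑[ Y ∈ kSets ] size (commonNbhd X)
      ≤⟨ ∑-mono-≤ kSets (λ X → ∑-mono-≤ kSets (λ Y → size-≤-∪ (commonNbhd X) (commonNbhd Y))) ⟩
    ∑[ X ∈ kSets ] ∑[ Y ∈ kSets ] size (pairUnion (X , Y))
      ≡⟨ ∑-cartesianProduct kSets kSets _ ⟨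
    ∑[ P ∈ pairs ] size (pairUnion P) ∎
    where open ≤-Reasoning

  ∑-degSum-pairUnion-≥ : TripartiteFree 1 1 k G →
                         2 * edgeWeight coverCount coverCount ≤ ∑[ P ∈ pairs ] degSum (pairUnion P)
  ∑-degSum-pairUnion-≥ free = begin
    2 * edgeWeight coverCount coverCount
      ≡⟨ cong (_+_ (edgeWeight coverCount coverCount)) (+-identityʳ _) ⟩
    edgeWeight coverCount coverCount + edgeWeight coverCount coverCount
      ≡⟨ cong₂ _+_ (edgeWeight-bilinear kSets kSets 𝟙I 𝟙I)
                   (trans (∑-comm kSets kSets _) (edgeWeight-bilinear kSets kSets 𝟙I 𝟙I)) ⟨
    (∑[ X ∈ kSets ] ∑[ Y ∈ kSets ] edgeWeight (𝟙I X) (𝟙I Y))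
      + (∑[ X ∈ kSets ] ∑[ Y ∈ kSets ] edgeWeight (𝟙I Y) (𝟙I X))
      ≡⟨ trans (∑-cong kSets (λ X → ∑-distrib-+ kSets _ _)) (∑-distrib-+ kSets _ _) ⟨
    ∑[ X ∈ kSets ] ∑[ Y ∈ kSets ] (edgeWeight (𝟙I X) (𝟙I Y) + edgeWeight (𝟙I Y) (𝟙I X))
      ≤⟨ ∑-mono-≤-∈ kSets (λ X∈ → ∑-mono-≤ kSets (λ Y →
           cross-edgeWeight-≤-degSum (commonNbhd Y) (∈kSets⇒independent free X∈))) ⟩
    ∑[ X ∈ kSets ] ∑[ Y ∈ kSets ] degSum (pairUnion (X , Y))
      ≡⟨ ∑-cartesianProduct kSets kSets _ ⟨
    ∑[ P ∈ pairs ] degSum (pairUnion P) ∎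
    where
    open ≤-Reasoning
    𝟙I : Vec (Fin n) k → Fin n → ℕ
    𝟙I X = 𝟙 ∘ commonNbhd X

  densePair : TripartiteFree 1 1 k G → ∀ {d} → MinDegreeAtLeast G d → 0 < d → k ≤ d → d ≤ n →
              ∃[ P ] P ∈ₗ pairs × 0 < d * (d C k) * size (pairUnion P)
                               × d * (d C k) * size (pairUnion P) ≤ (n C k) * degSum (pairUnion P)
  densePair free {d} δ≥d 0<d k≤d d≤n =
    subst (λ N → ∃[ P ] P ∈ₗ pairs × 0 < a * size (pairUnion P) × a * size (pairUnion P) ≤ N * degSum (pairUnion P))
          length-kSets (∑-averaging pairs size≡0⇒ ∑≤∑ 0<∑)
    where
    D = d C k
    a = d * D
    N = length kSets
    0<a : 0 < a
    0<a = *-mono-≤ 0<d (k≤n⇒0<nCk k k≤d)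
    0<N : 0 < N
    0<N = subst (0 <_) (sym length-kSets) (k≤n⇒0<nCk k (≤-trans k≤d d≤n))
    0<totalCover : 0 < totalCover
    0<totalCover = ≤-trans (*-mono-≤ (subst (0 <_) (sym (length-tabulate id)) (≤-trans 0<d d≤n))
                                     (k≤n⇒0<nCk k k≤d))
                           (≤-trans (≤-reflexive (sym (∑-const V D))) (∑-mono-≤ V (coverCount-≥ δ≥d)))
    size≡0⇒ : ∀ P → a * size (pairUnion P) ≡ 0 → N * degSum (pairUnion P) ≡ 0
    size≡0⇒ P a·size≡0 = trans (cong (N *_) (size≡0⇒degSum≡0 (pairUnion P) size≡0)) (*-zeroʳ N)
      where size≡0 = m*n≡0⇒m≡0 (size (pairUnion P)) a {{>-nonZero 0<a}} (trans (*-comm _ a) a·size≡0)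
    ∑≤∑ : ∑[ P ∈ pairs ] a * size (pairUnion P) ≤ ∑[ P ∈ pairs ] N * degSum (pairUnion P)
    ∑≤∑ = begin
      ∑[ P ∈ pairs ] a * size (pairUnion P)       ≡⟨ ∑-*ˡ pairs a _ ⟩
      a * (∑[ P ∈ pairs ] size (pairUnion P))     ≤⟨ *-monoʳ-≤ a ∑-size-pairUnion-≤ ⟩
      a * (2 * (N * totalCover))                  ≡⟨ rearrange d D N totalCover ⟩
      N * (2 * (totalCover * (D * d)))            ≤⟨ *-monoʳ-≤ N (*-monoʳ-≤ 2 (edgeWeight-≥ δ≥d (coverCount-≥ δ≥d))) ⟩
      N * (2 * edgeWeight coverCount coverCount)  ≤⟨ *-monoʳ-≤ N (∑-degSum-pairUnion-≥ free) ⟩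
      N * (∑[ P ∈ pairs ] degSum (pairUnion P))   ≡⟨ ∑-*ˡ pairs N _ ⟨
      ∑[ P ∈ pairs ] N * degSum (pairUnion P)     ∎
      where
      open ≤-Reasoning
      rearrange : ∀ d D N M → d * D * (2 * (N * M)) ≡ N * (2 * (M * (D * d)))
      rearrange = solve-∀
    0<∑ : 0 < ∑[ P ∈ pairs ] a * size (pairUnion P)
    0<∑ = ≤-trans (*-mono-≤ 0<a (*-mono-≤ 0<N 0<totalCover))
            (≤-trans (*-monoʳ-≤ a ∑-size-pairUnion-≥) (≤-reflexive (sym (∑-*ˡ pairs a _))))

  denseBipartiteInducedSubgraph : ∀ {d} → TripartiteFree 1 1 k G → MinDegreeAtLeast G d →
    0 < d → k ≤ d → d ≤ n →
    Σ (Subset n) λ S → BipartiteInduced G S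
      × (∀ v → v ∈ S → ((d * (d C k)) ÷ℕ (2 * (n C k))) ≤ℚ ℕtoℚ (inducedDegree G S v))
  denseBipartiteInducedSubgraph {d} free δ≥d 0<d k≤d d≤n
    with (X , Y) , XY∈ , 0<a·size , ratio ← densePair free δ≥d 0<d k≤d d≤n
    with X∈ , Y∈ ← ∈-cartesianProduct⁻ kSets kSets XY∈
    = denseUnion⇒bipartite {a = d * (d C k)} {N = n C k}
        (∈kSets⇒independent free X∈) (∈kSets⇒independent free Y∈) 0<a·size ratio

proposition7p2 : (r : ℕ) → 3 ≤ r → (n d : ℕ) → r ∸ 2 ≤ d → 2 * d ≤ n →
    (G : Graph n) → TripartiteFree 1 1 (r ∸ 2) G → MinDegreeAtLeast G d →
    FracChromaticAtMost G ((n C (r ∸ 2)) ÷ℕ (d C (r ∸ 2)))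
    × Σ (Subset n) (λ S → BipartiteInduced G S
        × (∀ v → v ∈ S →
             ((d * (d C (r ∸ 2))) ÷ℕ (2 * (n C (r ∸ 2)))) ≤ℚ ℕtoℚ (inducedDegree G S v)))
proposition7p2 r 3≤r n d k≤d 2d≤n G free δ≥d =
  fractionalChromatic-≤ free δ≥d k≤d , denseBipartiteInducedSubgraph free δ≥d 0<d k≤d d≤n
  where
  open CommonNeighbourhoods G (r ∸ 2)
  0<d : 0 < d
  0<d = ≤-trans (∸-monoˡ-≤ 2 3≤r) k≤d
  d≤n : d ≤ n
  d≤n = ≤-trans (m≤m+n d (d + 0)) 2d≤n
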